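{- Let $R$ be a finite commutative chain ring, $E$ a finite set, $C\le R^E$ an $R$-code and $X\subseteq E$. Then $M(C^X)=M(C)\backslash X$.
   Context: $R$ is local with maximal ideal $\mathfrak{m}$. Vectors are modular independent if $\sum\alpha_iv_i=0$ implies all $\alpha_i\in\mathfrak{m}$. For a generator matrix $G$ of $C$ (rows forming a minimal generating set of $C$; columns indexed by $E$), $M(C)$ is the independence system on $E$ whose independent sets are the $I\subseteq E$ such that the columns of $G$ indexed by $I$ are modular independent (independent of the choice of $G$). The punctured code is $C^X=\{\mathbf{c}|_{E\setminus X}:\mathbf{c}\in C\}\le R^{E\setminus X}$. For an independence system $M$ on $E$, the deletion $M\backslash X$ is the independence system on $E\setminus X$ whose independent sets are the independent sets of $M$ contained in $E\setminus X$ (equivalently, whose circuits are the circuits of $M$ contained in $E\setminus X$). -}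

module Defs where

open import Level using (Level; _⊔_; suc)
open import Algebra.Bundles using (CommutativeRing)
open import Data.Nat.Base using (ℕ)
open import Data.Fin.Base using (Fin)
open import Data.Fin.Subset using (Subset; _∈_; _∉_; ⊤)
open import Data.Product using (Σ; ∃; _×_)
open import Data.Sum using (_⊎_)
open import Relation.Nullary using (¬_)
open import Relation.Unary using (Pred; _⊆_)
open import Relation.Binary.PropositionalEquality using (_≡_)
import Relation.Binary.PropositionalEquality as ≡
open import Function.Bundles using (Inverse)
import Algebra.Properties.Monoid.Sum as MonoidSum

module _ {c ℓ : Level} (R : CommutativeRing c ℓ) where
  open CommutativeRing R
  open MonoidSum +-monoid using (sum)

  IsFiniteRing : Set (c ⊔ ℓ)
  IsFiniteRing = Σ ℕ λ q → Inverse setoid (≡.setoid (Fin q))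

  record IsIdeal (I : Pred Carrier (c ⊔ ℓ)) : Set (c ⊔ ℓ) where
    field
      resp  : ∀ {x y} → x ≈ y → I x → I y
      zero∈ : I 0#
      +-closed : ∀ {x y} → I x → I y → I (x + y)
      *-closed : ∀ r {x} → I x → I (r * x)

  IsChainRing : Set (suc (c ⊔ ℓ))
  IsChainRing = ∀ (I J : Pred Carrier (c ⊔ ℓ)) → IsIdeal I → IsIdeal J → I ⊆ J ⊎ J ⊆ I

  record IsLocalWithMaximalIdeal (𝔪 : Pred Carrier (c ⊔ ℓ)) : Set (suc (c ⊔ ℓ)) where
    field
      ideal  : IsIdeal 𝔪
      proper : ¬ 𝔪 1#
      unique : ∀ (I : Pred Carrier (c ⊔ ℓ)) → IsIdeal I → ¬ I 1# → I ⊆ 𝔪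

  Word : ℕ → Set c
  Word n = Fin n → Carrier

  record IsCode {p : Level} {n : ℕ} (C : Pred (Word n) p) : Set (c ⊔ ℓ ⊔ p) where
    field
      resp     : ∀ {u v : Word n} → (∀ j → u j ≈ v j) → C u → C v
      zero∈    : C (λ _ → 0#)
      +-closed : ∀ {u v} → C u → C v → C (λ j → u j + v j)
      *-closed : ∀ r {u} → C u → C (λ j → r * u j)

  GeneratedBy : {p : Level} {n k : ℕ} → Pred (Word n) p → (Fin k → Word n) → Subset k → Set (c ⊔ ℓ ⊔ p)
  GeneratedBy {n = n} {k} C G S =
    ∀ (u : Word n) → C u →
      Σ (Fin k → Carrier) λ a → (∀ i → i ∉ S → a i ≈ 0#)
                              × (∀ j → u j ≈ sum (λ i → a i * G i j))

  record IsGeneratorMatrix {p : Level} {n k : ℕ} (C : Pred (Word n) p) (G : Fin k → Word n) : Set (c ⊔ ℓ ⊔ p) where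
    field
      rows∈     : ∀ i → C (G i)
      generates : GeneratedBy C G ⊤
      minimal   : ∀ (S : Subset k) → (Σ (Fin k) λ i → i ∉ S) → ¬ GeneratedBy C G S

  ModIndepCols : {n k : ℕ} → Pred Carrier (c ⊔ ℓ) → (Fin k → Word n) → Subset n → Set (c ⊔ ℓ)
  ModIndepCols {n} {k} 𝔪 G I =
    ∀ (α : Fin n → Carrier) → (∀ j → j ∉ I → α j ≈ 0#) →
      (∀ (r : Fin k) → sum (λ j → α j * G r j) ≈ 0#) →
      ∀ j → j ∈ I → 𝔪 (α j)

  -- M(C), computed from a generator matrix G: the predicate "independent".
  M : {n k : ℕ} → Pred Carrier (c ⊔ ℓ) → (Fin k → Word n) → Pred (Subset n) (c ⊔ ℓ)
  M 𝔪 G I = ModIndepCols 𝔪 G I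

  -- Puncturing.  The ground set E ∖ X is identified with Fin m via an
  -- injective ι : Fin m → Fin n whose image is exactly E ∖ X.

  Puncture : {p : Level} {n m : ℕ} → Pred (Word n) p → (Fin m → Fin n) → Pred (Word m) (c ⊔ ℓ ⊔ p)
  Puncture {n = n} C ι d = Σ (Word n) λ u → C u × (∀ i → d i ≈ u (ι i))

IsComplementEnum : {n m : ℕ} → Subset n → (Fin m → Fin n) → Set
IsComplementEnum {n} {m} X ι =
  (∀ i i' → ι i ≡ ι i' → i ≡ i') ×
  (∀ (j : Fin n) → (j ∉ X → Σ (Fin m) λ i → ι i ≡ j) × (∀ i → ι i ≡ j → j ∉ X))

-- Deletion M \ X of an independence system M on E = Fin n, as an
-- independence system on E ∖ X ≅ Fin m (via ι enumerating E ∖ X):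
-- I ⊆ E ∖ X is independent iff it (i.e. its image ι(I) ⊆ E, which
-- avoids X) is independent in M.
Deletion : {q : Level} {n m : ℕ} → Pred (Subset n) q → (Fin m → Fin n) → Pred (Subset m) q
Deletion {n = n} {m} M ι I =
  Σ (Subset n) λ J → (∀ j → (j ∈ J → Σ (Fin m) λ i → i ∈ I × ι i ≡ j)
                          × (∀ i → i ∈ I → ι i ≡ j → j ∈ J))
                   × M J

-- Whether the columns of a generator matrix indexed by I are modular independent depends on
-- the code C only through its annihilator {α | α · c = 0 for all c ∈ C}, since the rows of any
-- generator matrix span C. A vector γ on E ∖ X annihilates C^X exactly when its extension by
-- zero along ι annihilates C, and for injective ι extension by zero and restriction along ι
-- are mutually inverse between vectors supported on I and vectors supported on ι(I). Hence I is
-- independent in M(C^X) iff ι(I) is independent in M(C).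

{-# OPTIONS --safe #-}
module Submission where

open import Defs
open import Level using (Level; _⊔_)
open import Algebra.Bundles using (CommutativeRing)
open import Data.Bool.Base using (true; if_then_else_)
open import Data.Fin.Base using (Fin; punchIn)
open import Data.Fin.Properties using (_≟_; any?; punchInᵢ≢i)
open import Data.Fin.Subset using (Subset; _∈_; _∉_; ⊤)
open import Data.Fin.Subset.Properties using (_∈?_)
open import Data.Nat.Base using (ℕ; suc)
open import Data.Product using (∃; _×_; _,_; proj₁; proj₂; map₂)
open import Data.Vec.Base using (tabulate; lookup)
open import Data.Vec.Functional using (Vector)
open import Data.Vec.Properties using (lookup∘tabulate; []=⇒lookup; lookup⇒[]=)
open import Function.Base using (_∘_)
open import Function.Bundles using (_⇔_; mk⇔; Equivalence)
open import Function.Definitions using (Injective)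
open import Relation.Binary.Definitions using (_Respects_)
open import Relation.Binary.PropositionalEquality as ≡ using (_≡_; _≢_)
open import Relation.Nullary using (Dec; ¬_; yes; no; does; contradiction)
open import Relation.Nullary.Decidable using (_×-dec_)
open import Relation.Unary using (Pred; Decidable)
import Algebra.Properties.Semiring.Sum as SemiringSum
import Relation.Binary.Reasoning.Setoid as SetoidReasoning

does≡true⇔ : ∀ {a} {A : Set a} (a? : Dec A) → does a? ≡ true ⇔ A
does≡true⇔ (yes a) = mk⇔ (λ _ → a) (λ _ → ≡.refl)
does≡true⇔ (no ¬a) = mk⇔ (λ ()) (λ a → contradiction a ¬a)

∈-tabulate-does⇔ : ∀ {p n} {P : Pred (Fin n) p} (P? : Decidable P) j →
  j ∈ tabulate (does ∘ P?) ⇔ P j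
∈-tabulate-does⇔ P? j = mk⇔
  (λ j∈ → to (does≡true⇔ (P? j)) (≡.trans (≡.sym lookup-j) ([]=⇒lookup j∈)))
  (λ Pj → lookup⇒[]= j _ (≡.trans lookup-j (from (does≡true⇔ (P? j)) Pj)))
  where
  open Equivalence
  lookup-j : lookup (tabulate (does ∘ P?)) j ≡ does (P? j)
  lookup-j = lookup∘tabulate (does ∘ P?) j

IsImage : {n m : ℕ} → (Fin m → Fin n) → Subset m → Subset n → Set
IsImage {n} ι I J =
  ∀ (j : Fin n) → (j ∈ J → ∃ λ i → i ∈ I × ι i ≡ j) × (∀ i → i ∈ I → ι i ≡ j → j ∈ J)

∉-image : ∀ {n m} {ι : Fin m → Fin n} {I J i} →
  Injective _≡_ _≡_ ι → IsImage ι I J → i ∉ I → ι i ∉ J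
∉-image {I = I} ι-injective J-image i∉I ιi∈J with J-image _ .proj₁ ιi∈J
... | i' , i'∈I , ιi'≡ιi = i∉I (≡.subst (_∈ I) (ι-injective ιi'≡ιi) i'∈I)

hasPreimage? : {n m : ℕ} (ι : Fin m → Fin n) (I : Subset m) →
  Decidable λ j → ∃ λ i → i ∈ I × ι i ≡ j
hasPreimage? ι I j = any? λ i → (i ∈? I) ×-dec (ι i ≟ j)

image : {n m : ℕ} → (Fin m → Fin n) → Subset m → Subset n
image ι I = tabulate (does ∘ hasPreimage? ι I)

image-isImage : {n m : ℕ} (ι : Fin m → Fin n) (I : Subset m) → IsImage ι I (image ι I)
image-isImage ι I j =
  Equivalence.to j∈image⇔ , λ i i∈I ιi≡j → Equivalence.from j∈image⇔ (i , i∈I , ιi≡j)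
  where
  j∈image⇔ : j ∈ image ι I ⇔ (∃ λ i → i ∈ I × ι i ≡ j)
  j∈image⇔ = ∈-tabulate-does⇔ (hasPreimage? ι I) j

module _ {c ℓ : Level} (R : CommutativeRing c ℓ) where
  open CommutativeRing R
  open SemiringSum semiring
    using (sum; sum-cong-≋; sum-replicate-zero; sum-remove; ∑-comm; *-distribˡ-sum; *-distribʳ-sum)
  open SetoidReasoning setoid

  sum-zero : ∀ {n} (f : Vector Carrier n) → (∀ j → f j ≈ 0#) → sum f ≈ 0#
  sum-zero {n} f f≈0 = trans (sum-cong-≋ f≈0) (sum-replicate-zero n)

  sum-single : ∀ {n} (f : Vector Carrier n) i → (∀ j → j ≢ i → f j ≈ 0#) → sum f ≈ f i
  sum-single {suc n} f i f≈0 = begin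
    sum f                       ≈⟨ sum-remove f ⟩
    f i + sum (f ∘ punchIn i)   ≈⟨ +-congˡ (sum-zero _ λ j → f≈0 (punchIn i j) (punchInᵢ≢i i j)) ⟩
    f i + 0#                    ≈⟨ +-identityʳ (f i) ⟩
    f i                         ∎

  _·_ : ∀ {n} → Vector Carrier n → Vector Carrier n → Carrier
  β · u = sum λ j → β j * u j

  ·-cong : ∀ {n} {β β' u u' : Vector Carrier n} →
    (∀ j → β j ≈ β' j) → (∀ j → u j ≈ u' j) → β · u ≈ β' · u'
  ·-cong β≈β' u≈u' = sum-cong-≋ λ j → *-cong (β≈β' j) (u≈u' j)

  ·-linearCombination : ∀ {n k} (β : Vector Carrier n) (a : Vector Carrier k) (G : Fin k → Word R n) →
    β · (λ j → sum λ r → a r * G r j) ≈ sum λ r → a r * (β · G r)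
  ·-linearCombination β a G = begin
    sum (λ j → β j * sum (λ r → a r * G r j))
      ≈⟨ sum-cong-≋ (λ j → *-distribˡ-sum (β j) λ r → a r * G r j) ⟩
    sum (λ j → sum (λ r → β j * (a r * G r j)))
      ≈⟨ ∑-comm (λ j r → β j * (a r * G r j)) ⟩
    sum (λ r → sum (λ j → β j * (a r * G r j)))
      ≈⟨ sum-cong-≋ (λ r → sum-cong-≋ λ j → x*[y*z]≈y*[x*z] (β j) (a r) (G r j)) ⟩
    sum (λ r → sum (λ j → a r * (β j * G r j)))
      ≈⟨ sum-cong-≋ (λ r → sym (*-distribˡ-sum (a r) λ j → β j * G r j)) ⟩
    sum (λ r → a r * (β · G r))
      ∎
    where
    x*[y*z]≈y*[x*z] : ∀ x y z → x * (y * z) ≈ y * (x * z)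
    x*[y*z]≈y*[x*z] x y z = trans (sym (*-assoc x y z)) (trans (*-congʳ (*-comm x y)) (*-assoc y x z))

  Annihilates : ∀ {p n} → Vector Carrier n → Pred (Word R n) p → Set (c ⊔ ℓ ⊔ p)
  Annihilates β C = ∀ {u} → C u → β · u ≈ 0#

  annihilates-generated : ∀ {p n k} {C : Pred (Word R n) p} {G : Fin k → Word R n} {β : Vector Carrier n} →
    GeneratedBy R C G ⊤ → (∀ r → β · G r ≈ 0#) → Annihilates β C
  annihilates-generated {G = G} {β} generates β·G≈0 {u} u∈C with generates u u∈C
  ... | a , _ , u≈aG = begin
    β · u                               ≈⟨ ·-cong (λ _ → refl) u≈aG ⟩
    β · (λ j → sum λ r → a r * G r j)   ≈⟨ ·-linearCombination β a G ⟩
    sum (λ r → a r * (β · G r))         ≈⟨ sum-zero _ (λ r → trans (*-congˡ (β·G≈0 r)) (zeroʳ _)) ⟩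
    0#                                  ∎

  extendByZero : ∀ {n m} → (Fin m → Fin n) → Vector Carrier m → Vector Carrier n
  extendByZero ι γ j = sum λ i → if does (ι i ≟ j) then γ i else 0#

  extendByZero-outside : ∀ {n m} (ι : Fin m → Fin n) (γ : Vector Carrier m) j →
    (∀ i → ι i ≡ j → γ i ≈ 0#) → extendByZero ι γ j ≈ 0#
  extendByZero-outside ι γ j γ≈0 = sum-zero _ term≈0
    where
    term≈0 : ∀ i → (if does (ι i ≟ j) then γ i else 0#) ≈ 0#
    term≈0 i with ι i ≟ j
    ... | yes ιi≡j = γ≈0 i ιi≡j
    ... | no _     = refl

  extendByZero-∘ : ∀ {n m} {ι : Fin m → Fin n} → Injective _≡_ _≡_ ι →
    ∀ (γ : Vector Carrier m) i → extendByZero ι γ (ι i) ≈ γ i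
  extendByZero-∘ {ι = ι} ι-injective γ i = trans (sum-single _ i term≈0) term≈γ
    where
    term≈0 : ∀ i' → i' ≢ i → (if does (ι i' ≟ ι i) then γ i' else 0#) ≈ 0#
    term≈0 i' i'≢i with ι i' ≟ ι i
    ... | yes ιi'≡ιi = contradiction (ι-injective ιi'≡ιi) i'≢i
    ... | no _       = refl
    term≈γ : (if does (ι i ≟ ι i) then γ i else 0#) ≈ γ i
    term≈γ with ι i ≟ ι i
    ... | yes _    = refl
    ... | no ιi≢ιi = contradiction ≡.refl ιi≢ιi

  extendByZero-restrict : ∀ {n m} {ι : Fin m → Fin n} → Injective _≡_ _≡_ ι →
    ∀ (β : Vector Carrier n) → (∀ j → ¬ (∃ λ i → ι i ≡ j) → β j ≈ 0#) →
    ∀ j → extendByZero ι (β ∘ ι) j ≈ β j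
  extendByZero-restrict {ι = ι} ι-injective β β≈0 j with any? (λ i → ι i ≟ j)
  ... | yes (i , ≡.refl) = extendByZero-∘ ι-injective (β ∘ ι) i
  ... | no  ∄i = trans (extendByZero-outside ι (β ∘ ι) j λ i ιi≡j → contradiction (i , ιi≡j) ∄i)
                       (sym (β≈0 j ∄i))

  extendByZero-· : ∀ {n m} (ι : Fin m → Fin n) (γ : Vector Carrier m) (u : Vector Carrier n) →
    extendByZero ι γ · u ≈ γ · (u ∘ ι)
  extendByZero-· ι γ u = begin
    sum (λ j → sum (λ i → t i j) * u j)   ≈⟨ sum-cong-≋ (λ j → *-distribʳ-sum (u j) λ i → t i j) ⟩
    sum (λ j → sum (λ i → t i j * u j))   ≈⟨ ∑-comm (λ j i → t i j * u j) ⟩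
    sum (λ i → sum (λ j → t i j * u j))   ≈⟨ sum-cong-≋ (λ i → sum-single _ (ι i) (term≈0 i)) ⟩
    sum (λ i → t i (ι i) * u (ι i))       ≈⟨ sum-cong-≋ (λ i → *-congʳ (diagonal i)) ⟩
    γ · (u ∘ ι)                           ∎
    where
    t : Fin _ → Fin _ → Carrier
    t i j = if does (ι i ≟ j) then γ i else 0#
    term≈0 : ∀ i j → j ≢ ι i → t i j * u j ≈ 0#
    term≈0 i j j≢ιi with ι i ≟ j
    ... | yes ιi≡j = contradiction (≡.sym ιi≡j) j≢ιi
    ... | no _     = zeroˡ (u j)
    diagonal : ∀ i → t i (ι i) ≈ γ i
    diagonal i with ι i ≟ ι i
    ... | yes _    = refl
    ... | no ιi≢ιi = contradiction ≡.refl ιi≢ιi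

  annihilates-puncture⇔ : ∀ {p n m} {C : Pred (Word R n) p} (ι : Fin m → Fin n) (γ : Vector Carrier m) →
    Annihilates γ (Puncture R C ι) ⇔ Annihilates (extendByZero ι γ) C
  annihilates-puncture⇔ {C = C} ι γ = mk⇔ puncture⇒extension extension⇒puncture
    where
    puncture⇒extension : Annihilates γ (Puncture R C ι) → Annihilates (extendByZero ι γ) C
    puncture⇒extension γ⊥C^ι u∈C = trans (extendByZero-· ι γ _) (γ⊥C^ι (_ , u∈C , λ _ → refl))

    extension⇒puncture : Annihilates (extendByZero ι γ) C → Annihilates γ (Puncture R C ι)
    extension⇒puncture ext⊥C (u , u∈C , d≈u∘ι) = begin
      γ · _                  ≈⟨ ·-cong (λ _ → refl) d≈u∘ι ⟩
      γ · (u ∘ ι)            ≈⟨ sym (extendByZero-· ι γ u) ⟩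
      extendByZero ι γ · u   ≈⟨ ext⊥C u∈C ⟩
      0#                     ∎

  SupportedOn : ∀ {n} → Vector Carrier n → Subset n → Set ℓ
  SupportedOn α I = ∀ j → j ∉ I → α j ≈ 0#

  IsModIndep : ∀ {q p n} → Pred Carrier q → Pred (Word R n) p → Subset n → Set (c ⊔ ℓ ⊔ q ⊔ p)
  IsModIndep 𝔪 C I = ∀ α → SupportedOn α I → Annihilates α C → ∀ j → j ∈ I → 𝔪 (α j)

  M⇔IsModIndep : ∀ {p n k} {C : Pred (Word R n) p} {G : Fin k → Word R n} →
    IsGeneratorMatrix R C G → ∀ 𝔪 I → M R 𝔪 G I ⇔ IsModIndep 𝔪 C I
  M⇔IsModIndep {C = C} {G} G-gen 𝔪 I = mk⇔ M⇒IsModIndep IsModIndep⇒M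
    where
    open IsGeneratorMatrix G-gen

    M⇒IsModIndep : M R 𝔪 G I → IsModIndep 𝔪 C I
    M⇒IsModIndep indep α α-supp α⊥C = indep α α-supp λ r → α⊥C (rows∈ r)

    IsModIndep⇒M : IsModIndep 𝔪 C I → M R 𝔪 G I
    IsModIndep⇒M indep α α-supp α⊥G = indep α α-supp (annihilates-generated generates α⊥G)

  IsModIndep-Puncture⇒image : ∀ {q p n m} {𝔪 : Pred Carrier q} {C : Pred (Word R n) p}
    {ι : Fin m → Fin n} {I J} → Injective _≡_ _≡_ ι → IsImage ι I J →
    IsModIndep 𝔪 (Puncture R C ι) I → IsModIndep 𝔪 C J
  IsModIndep-Puncture⇒image {C = C} {ι} {I} ι-injective J-image indep β β-supp β⊥C j j∈J
    with J-image j .proj₁ j∈J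
  ... | i , i∈I , ≡.refl = indep (β ∘ ι) β∘ι-supp β∘ι⊥C^ι i i∈I
    where
    β-outsideImage : ∀ j → ¬ (∃ λ i → ι i ≡ j) → β j ≈ 0#
    β-outsideImage j ∄i = β-supp j λ j∈J → ∄i (map₂ proj₂ (J-image j .proj₁ j∈J))

    β∘ι-supp : SupportedOn (β ∘ ι) I
    β∘ι-supp i i∉I = β-supp (ι i) (∉-image ι-injective J-image i∉I)

    β∘ι⊥C^ι : Annihilates (β ∘ ι) (Puncture R C ι)
    β∘ι⊥C^ι = Equivalence.from (annihilates-puncture⇔ ι (β ∘ ι)) λ u∈C →
      trans (·-cong (extendByZero-restrict ι-injective β β-outsideImage) λ _ → refl) (β⊥C u∈C)

  IsModIndep-image⇒Puncture : ∀ {q p n m} {𝔪 : Pred Carrier q} {C : Pred (Word R n) p}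
    {ι : Fin m → Fin n} {I J} → Injective _≡_ _≡_ ι → IsImage ι I J → 𝔪 Respects _≈_ →
    IsModIndep 𝔪 C J → IsModIndep 𝔪 (Puncture R C ι) I
  IsModIndep-image⇒Puncture {ι = ι} {J = J} ι-injective J-image 𝔪-resp indep α α-supp α⊥C^ι i i∈I =
    𝔪-resp (extendByZero-∘ ι-injective α i)
      (indep (extendByZero ι α) ext-supp (Equivalence.to (annihilates-puncture⇔ ι α) α⊥C^ι)
             (ι i) (J-image (ι i) .proj₂ i i∈I ≡.refl))
    where
    ext-supp : SupportedOn (extendByZero ι α) J
    ext-supp j j∉J = extendByZero-outside ι α j λ i ιi≡j →
      α-supp i λ i∈I → j∉J (J-image j .proj₂ i i∈I ιi≡j)

lemma4p4 : ∀ {c ℓ p : Level} (R : CommutativeRing c ℓ) →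
    IsFiniteRing R → IsChainRing R →
    (𝔪 : Pred (CommutativeRing.Carrier R) (c ⊔ ℓ)) → IsLocalWithMaximalIdeal R 𝔪 →
    ∀ {n : ℕ} (C : Pred (Word R n) p) → IsCode R C →
    ∀ (X : Subset n) {m : ℕ} (ι : Fin m → Fin n) → IsComplementEnum X ι →
    ∀ {k k' : ℕ} (G : Fin k → Word R n) → IsGeneratorMatrix R C G →
    (G' : Fin k' → Word R m) → IsGeneratorMatrix R (Puncture R C ι) G' →
    ∀ (I : Subset m) →
      (M R 𝔪 G' I → Deletion (M R 𝔪 G) ι I) × (Deletion (M R 𝔪 G) ι I → M R 𝔪 G' I)
lemma4p4 R _ _ 𝔪 local C _ _ ι (ι-injective′ , _) G G-gen G' G'-gen I = M'⇒Deletion , Deletion⇒M'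
  where
  open CommutativeRing R using (_≈_)
  open Equivalence using (to; from)

  ι-injective : Injective _≡_ _≡_ ι
  ι-injective = ι-injective′ _ _

  𝔪-resp : 𝔪 Respects _≈_
  𝔪-resp = IsIdeal.resp (IsLocalWithMaximalIdeal.ideal local)

  M⇔C : ∀ J → M R 𝔪 G J ⇔ IsModIndep R 𝔪 C J
  M⇔C = M⇔IsModIndep R G-gen 𝔪

  M'⇔C^ι : ∀ I → M R 𝔪 G' I ⇔ IsModIndep R 𝔪 (Puncture R C ι) I
  M'⇔C^ι = M⇔IsModIndep R G'-gen 𝔪

  M'⇒Deletion : M R 𝔪 G' I → Deletion (M R 𝔪 G) ι I
  M'⇒Deletion indep = image ι I , image-isImage ι I ,
    from (M⇔C (image ι I))
      (IsModIndep-Puncture⇒image R {𝔪 = 𝔪} ι-injective (image-isImage ι I) (to (M'⇔C^ι I) indep))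

  Deletion⇒M' : Deletion (M R 𝔪 G) ι I → M R 𝔪 G' I
  Deletion⇒M' (J , J-image , indep) =
    from (M'⇔C^ι I) (IsModIndep-image⇒Puncture R ι-injective J-image 𝔪-resp (to (M⇔C J) indep))
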